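{- Let $l\ge2$, $q=1(l+1)l\ldots2$, $n\ge l+1$, and $k=k_n$. Let $p\in S_n$ be a layered $q$-optimal permutation whose last layer has length $m=n-k$, let $b$ be the length of the penultimate layer of $p$, and let $a=k-b$ (the length of what remains after removing the last two layers of $p$). Then (i) $b\le m$; (ii) $a\le (m-l+1)/l$; (iii) $k<n/l$, and in particular $k<m$; (iv) $m\le l(n+1)/(l+1)$.
   Context: $q=1(l+1)l\ldots2$ is the permutation of length $l+1$ with first entry $1$ followed by $l+1,l,\ldots,2$. For $p\in S_n$, $c_q(p)$ is the number of subsequences of $p$ of length $l+1$ in the same relative order as $q$; $M_j=\max_{p\in S_j}c_q(p)$; $p$ is $q$-optimal if $c_q(p)=M_n$. A permutation is layered if it is a concatenation of decreasing subwords (layers) with every entry of a layer smaller than every entry of each later layer. For $n\ge2$, $k_n$ is the largest $k\in\{1,\ldots,n-1\}$ maximizing $M_k+k\binom{n-k}{l}$. -}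

module Defs where

open import Data.Nat using (ℕ; zero; suc; _+_; _*_; _∸_; _≤_; _<_; _<ᵇ_)
open import Data.Nat.Combinatorics using (_C_)
open import Data.Bool using (Bool; true; false; _∧_; if_then_else_)
open import Data.Bool.Properties using () renaming (_≟_ to _≟ᵇ_)
open import Data.List using (List; []; _∷_; length; map; zip; concat; upTo; downFrom)
open import Data.Bool.ListAction using (and)
open import Data.Nat.ListAction using (sum)
open import Data.List.Relation.Unary.All using (All)
open import Data.List.Relation.Unary.Linked using (Linked)
open import Data.List.Relation.Binary.Pointwise using ()
open import Data.List.Relation.Unary.AllPairs using (AllPairs)
open import Data.List.Relation.Binary.Permutation.Propositional using (_↭_)
open import Data.Product using (Σ; _×_)
open import Relation.Binary.PropositionalEquality using (_≡_)
open import Relation.Nullary using (¬_)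
open import Relation.Nullary.Decidable using (⌊_⌋)

_==_ : Bool → Bool → Bool
b == c = ⌊ b ≟ᵇ c ⌋

subseqs : {A : Set} → ℕ → List A → List (List A)
subseqs zero    _        = [] ∷ []
subseqs (suc k) []       = []
subseqs (suc k) (x ∷ xs) = map (x ∷_) (subseqs k xs) Data.List.++ subseqs (suc k) xs

orderIso : List ℕ → List ℕ → Bool
orderIso [] [] = true
orderIso (x ∷ xs) (y ∷ ys) =
  and (map (λ pr → ((x <ᵇ Data.Product.proj₁ pr) == (y <ᵇ Data.Product.proj₂ pr))
                 ∧ ((Data.Product.proj₁ pr <ᵇ x) == (Data.Product.proj₂ pr <ᵇ y)))
           (zip xs ys))
  ∧ orderIso xs ys
orderIso _ _ = false

-- the pattern q = 1 (l+1) l ... 2, written with values shifted down by one: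
-- 0 , l , l-1 , ... , 1   (same relative order)
qpat : ℕ → List ℕ
qpat l = 0 ∷ map suc (downFrom l)

count : List ℕ → List ℕ → ℕ
count q p = sum (map (λ s → if orderIso s q then 1 else 0) (subseqs (length q) p))

-- S_n : permutations of {0,...,n-1}, as lists (one-line notation)
IsPerm : ℕ → List ℕ → Set
IsPerm n p = p ↭ upTo n

IsMaxCount : List ℕ → ℕ → ℕ → Set
IsMaxCount q j v = Σ (List ℕ) (λ p → IsPerm j p × count q p ≡ v)
                 × ((p : List ℕ) → IsPerm j p → count q p ≤ v)

Optimal : List ℕ → ℕ → List ℕ → Set
Optimal q n p = IsPerm n p × ((p' : List ℕ) → IsPerm n p' → count q p' ≤ count q p)

-- k = k_n (for q = qpat l): largest k ∈ {1..n-1} maximizing M_k + k * C(n-k, l)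
IsKn : ℕ → ℕ → ℕ → Set
IsKn l n k =
  1 ≤ k × k < n ×
  ((k' : ℕ) → 1 ≤ k' → k' < n → (v v' : ℕ) →
     IsMaxCount (qpat l) k v → IsMaxCount (qpat l) k' v' →
     (v' + k' * ((n ∸ k') C l) ≤ v + k * ((n ∸ k) C l))
     × (v' + k' * ((n ∸ k') C l) ≡ v + k * ((n ∸ k) C l) → k' ≤ k))

Decreasing : List ℕ → Set
Decreasing = Linked (λ x y → y < x)

NonEmpty : List ℕ → Set
NonEmpty xs = ¬ (xs ≡ [])

Layers : List (List ℕ) → List ℕ → Set
Layers Ls p =
  concat Ls ≡ p × All NonEmpty Ls × All Decreasing Ls ×
  AllPairs (λ A B → All (λ x → All (λ y → x < y) B) A) Ls

{-# OPTIONS --safe #-}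
-- In a layered permutation with layer sizes c₁, …, c_r (bottom to top) an occurrence of
-- q = 1(l+1)l…2 takes its 1 from one layer and its l decreasing entries from a single later
-- layer, so c_q = Σᵢ (c₁ + ⋯ + c_{i−1}) · C(cᵢ, l).  Every composition of n is realised by a
-- layered permutation, so the layer sizes of a q-optimal layered p maximise this sum.  With a
-- entries below the last two layers, of sizes b and m, comparing with swapping these two layers,
-- merging them, moving one entry from the penultimate layer to the last, and splitting one entry
-- off the last layer gives (i)–(iv); each comparison becomes linear in m through
-- C(m, l) / C(m, l − 1) = (m − l + 1) / l.
module Submission where

open import Defs
open import Data.Nat using (ℕ; zero; suc; _+_; _*_; _∸_; _≤_; _<_; _>_; _<ᵇ_; z≤n; s≤s; _≤?_; >-nonZero)
open import Data.Nat.Properties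
open import Data.Nat.Combinatorics using (_C_; nCk+nC[k+1]≡[n+1]C[k+1]; nC1≡n; k>n⇒nCk≡0)
open import Data.Nat.ListAction using (sum)
open import Data.Nat.ListAction.Properties using (sum-++)
open import Data.Nat.Tactic.RingSolver using (solve-∀)
open import Data.Bool using (Bool; true; false; _∧_; if_then_else_)
open import Data.Bool.Properties using (∧-zeroʳ)
open import Data.Bool.ListAction using (and)
open import Data.List using (List; []; _∷_; _++_; length; map; zip; concat; downFrom; applyUpTo; applyDownFrom)
open import Data.List.Properties
  using (map-++; map-∘; length-map; length-++; ++-assoc; ++-identityʳ; length-upTo; length-downFrom;
         length-applyDownFrom; reverse-applyUpTo)
open import Data.List.Relation.Unary.All as All using (All; []; _∷_)
import Data.List.Relation.Unary.All.Properties as All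
open import Data.List.Relation.Unary.AllPairs using (AllPairs; []; _∷_)
import Data.List.Relation.Unary.AllPairs.Properties as AllPairs
import Data.List.Relation.Unary.Linked.Properties as Linked
open import Data.List.Relation.Binary.Permutation.Propositional using (_↭_; ↭-refl; ↭-trans; ↭-reflexive)
import Data.List.Relation.Binary.Permutation.Propositional.Properties as Perm
open import Data.List.Relation.Binary.Sublist.Propositional using (_⊆_; []; _∷_; _∷ʳ_; minimum)
open import Data.List.Relation.Binary.Sublist.Propositional.Properties using (All-resp-⊆)
open import Data.Product using (_×_; _,_; proj₁; proj₂)
open import Function.Base using (id)
open import Relation.Binary.Definitions using (Monotonic₁)
open import Relation.Binary.PropositionalEquality
open import Relation.Nullary using (yes; no)
open import Relation.Nullary.Negation using (contradiction)
open import Algebra.Properties.CommutativeSemigroup +-commutativeSemigroup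
  using () renaming (interchange to +-interchange)
open import Algebra.Properties.CommutativeSemigroup *-commutativeSemigroup using (x∙yz≈y∙xz)

C-pascal : ∀ n k → suc n C suc k ≡ n C k + n C suc k
C-pascal n k = sym (nCk+nC[k+1]≡[n+1]C[k+1] n k)

C-pos : ∀ {n k} → k ≤ n → 0 < n C k
C-pos {n} {zero} _ = s≤s z≤n
C-pos {suc n} {suc k} (s≤s k≤n) rewrite C-pascal n k = <-≤-trans (C-pos k≤n) (m≤m+n _ _)

C-monoˡ-≤ : ∀ {m n} k → m ≤ n → m C k ≤ n C k
C-monoˡ-≤ zero _ = ≤-refl
C-monoˡ-≤ {zero} (suc k) _ = z≤n
C-monoˡ-≤ {suc m} {suc n} (suc k) (s≤s m≤n) rewrite C-pascal m k | C-pascal n k =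
  +-mono-≤ (C-monoˡ-≤ k m≤n) (C-monoˡ-≤ (suc k) m≤n)

C-monoˡ-< : ∀ {m n k} → k ≤ m → m < n → m C suc k < n C suc k
C-monoˡ-< {m} {suc n} {k} k≤m (s≤s m≤n) rewrite C-pascal n k =
  +-mono-≤ (C-pos (≤-trans k≤m m≤n)) (C-monoˡ-≤ (suc k) m≤n)

C-absorb : ∀ n k → suc k * (suc n C suc k) ≡ suc n * (n C k)
C-absorb n zero = trans (+-identityʳ _) (trans (nC1≡n (suc n)) (sym (*-identityʳ (suc n))))
C-absorb zero (suc k) = *-zeroʳ (suc (suc k))
C-absorb (suc n) (suc k) = begin
  suc (suc k) * (suc (suc n) C suc (suc k))
    ≡⟨ cong (suc (suc k) *_) (C-pascal (suc n) (suc k)) ⟩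
  suc (suc k) * (suc n C suc k + suc n C suc (suc k))
    ≡⟨ *-distribˡ-+ (suc (suc k)) (suc n C suc k) (suc n C suc (suc k)) ⟩
  (suc n C suc k + suc k * (suc n C suc k)) + suc (suc k) * (suc n C suc (suc k))
    ≡⟨ cong₂ (λ x y → (suc n C suc k + x) + y) (C-absorb n k) (C-absorb n (suc k)) ⟩
  (suc n C suc k + suc n * (n C k)) + suc n * (n C suc k)
    ≡⟨ +-assoc (suc n C suc k) (suc n * (n C k)) (suc n * (n C suc k)) ⟩
  suc n C suc k + (suc n * (n C k) + suc n * (n C suc k))
    ≡⟨ cong (suc n C suc k +_) (sym (*-distribˡ-+ (suc n) (n C k) (n C suc k))) ⟩
  suc n C suc k + suc n * (n C k + n C suc k)
    ≡⟨ cong (λ x → suc n C suc k + suc n * x) (sym (C-pascal n k)) ⟩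
  suc (suc n) * (suc n C suc k)
    ∎
  where open ≡-Reasoning

C-step : ∀ n k → suc k * (n C suc k) + suc k * (n C k) ≡ suc n * (n C k)
C-step n k = begin
  suc k * (n C suc k) + suc k * (n C k) ≡⟨ +-comm (suc k * (n C suc k)) (suc k * (n C k)) ⟩
  suc k * (n C k) + suc k * (n C suc k) ≡⟨ sym (*-distribˡ-+ (suc k) (n C k) (n C suc k)) ⟩
  suc k * (n C k + n C suc k)           ≡⟨ cong (suc k *_) (sym (C-pascal n k)) ⟩
  suc k * (suc n C suc k)               ≡⟨ C-absorb n k ⟩
  suc n * (n C k)                       ∎
  where open ≡-Reasoning

C-superadditive : ∀ m n k → m C suc k + n C suc k ≤ (m + n) C suc k
C-superadditive zero n k = ≤-refl
C-superadditive (suc m) n k = begin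
  suc m C suc k + n C suc k            ≡⟨ cong (_+ n C suc k) (C-pascal m k) ⟩
  (m C k + m C suc k) + n C suc k      ≡⟨ +-assoc (m C k) (m C suc k) (n C suc k) ⟩
  m C k + (m C suc k + n C suc k)      ≤⟨ +-mono-≤ (C-monoˡ-≤ k (m≤m+n m n)) (C-superadditive m n k) ⟩
  (m + n) C k + (m + n) C suc k        ≡⟨ sym (C-pascal (m + n) k) ⟩
  suc (m + n) C suc k                  ∎
  where open ≤-Reasoning

-- Three terms of Vandermonde's identity C(m + n, r) = Σᵢ C(m, i) · C(n, r − i).
C-+-lowerBound : ∀ m n k → m C suc (suc k) + n C suc (suc k) + m * (n C suc k) ≤ (m + n) C suc (suc k)
C-+-lowerBound zero n k = ≤-reflexive (+-identityʳ (n C suc (suc k)))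
C-+-lowerBound (suc m) n k = begin
  suc m C suc (suc k) + n C suc (suc k) + suc m * (n C suc k)
    ≡⟨ cong (λ x → x + n C suc (suc k) + suc m * (n C suc k)) (C-pascal m (suc k)) ⟩
  (m C suc k + m C suc (suc k)) + n C suc (suc k) + (n C suc k + m * (n C suc k))
    ≡⟨ regroup (m C suc k) (m C suc (suc k)) (n C suc (suc k)) (n C suc k) (m * (n C suc k)) ⟩
  (m C suc k + n C suc k) + (m C suc (suc k) + n C suc (suc k) + m * (n C suc k))
    ≤⟨ +-mono-≤ (C-superadditive m n k) (C-+-lowerBound m n k) ⟩
  (m + n) C suc k + (m + n) C suc (suc k)
    ≡⟨ sym (C-pascal (m + n) (suc k)) ⟩
  suc (m + n) C suc (suc k)
    ∎
  where
  open ≤-Reasoning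
  regroup : ∀ p q r s t → (p + q) + r + (s + t) ≡ (p + s) + (q + r + t)
  regroup = solve-∀

C-absorb-scaled : ∀ x n k → suc k * (x * (suc n C suc k)) ≡ x * suc n * (n C k)
C-absorb-scaled x n k = begin
  suc k * (x * (suc n C suc k)) ≡⟨ x∙yz≈y∙xz (suc k) x (suc n C suc k) ⟩
  x * (suc k * (suc n C suc k)) ≡⟨ cong (x *_) (C-absorb n k) ⟩
  x * (suc n * (n C k))         ≡⟨ sym (*-assoc x (suc n) (n C k)) ⟩
  x * suc n * (n C k)           ∎
  where open ≡-Reasoning

C/n-mono-≤ : ∀ {m n} k → m ≤ n → n * (m C suc k) ≤ m * (n C suc k)
C/n-mono-≤ {zero} {n} k _ = ≤-reflexive (*-zeroʳ n)
C/n-mono-≤ {suc m} {suc n} k (s≤s m≤n) = *-cancelˡ-≤ (suc k) (begin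
  suc k * (suc n * (suc m C suc k)) ≡⟨ C-absorb-scaled (suc n) m k ⟩
  suc n * suc m * (m C k)           ≤⟨ *-monoʳ-≤ (suc n * suc m) (C-monoˡ-≤ k m≤n) ⟩
  suc n * suc m * (n C k)           ≡⟨ cong (_* (n C k)) (*-comm (suc n) (suc m)) ⟩
  suc m * suc n * (n C k)           ≡⟨ sym (C-absorb-scaled (suc m) n k) ⟩
  suc k * (suc m * (suc n C suc k)) ∎)
  where open ≤-Reasoning

C/n-mono-< : ∀ {m n k} → suc k ≤ m → m < n → n * (m C suc (suc k)) < m * (n C suc (suc k))
C/n-mono-< {suc m} {suc n} {k} (s≤s k≤m) (s≤s m<n) =
  *-cancelˡ-< (suc (suc k)) (suc n * (suc m C suc (suc k))) (suc m * (suc n C suc (suc k))) (begin-strict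
    suc (suc k) * (suc n * (suc m C suc (suc k))) ≡⟨ C-absorb-scaled (suc n) m (suc k) ⟩
    suc n * suc m * (m C suc k)                   <⟨ *-monoʳ-< (suc n * suc m) (C-monoˡ-< k≤m m<n) ⟩
    suc n * suc m * (n C suc k)                   ≡⟨ cong (_* (n C suc k)) (*-comm (suc n) (suc m)) ⟩
    suc m * suc n * (n C suc k)                   ≡⟨ sym (C-absorb-scaled (suc m) n (suc k)) ⟩
    suc (suc k) * (suc m * (suc n C suc (suc k))) ∎)
  where open ≤-Reasoning

-- C-step says C(m, k + 1) / C(m, k) = (m − k) / (k + 1); the ratio lemmas use it to turn bounds
-- between multiples of these two coefficients into linear bounds on m.
C-ratio-≤ : ∀ {m k} x y z → k ≤ m →
  x * (m C k) ≤ y * (m C suc k) + z * (m C k) → suc k * (x + y) ≤ y * suc m + suc k * z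
C-ratio-≤ {m} {k} x y z k≤m hyp = *-cancelʳ-≤ _ _ c {{>-nonZero (C-pos k≤m)}} (begin
  suc k * (x + y) * c                           ≡⟨ expandˡ (suc k) x y c ⟩
  suc k * (x * c) + y * (suc k * c)             ≤⟨ +-monoˡ-≤ (y * (suc k * c)) (*-monoʳ-≤ (suc k) hyp) ⟩
  suc k * (y * c′ + z * c) + y * (suc k * c)    ≡⟨ expandʳ (suc k) y z c c′ ⟩
  y * (suc k * c′ + suc k * c) + suc k * z * c  ≡⟨ cong (λ t → y * t + suc k * z * c) (C-step m k) ⟩
  y * (suc m * c) + suc k * z * c               ≡⟨ collect y (suc m) (suc k) z c ⟩
  (y * suc m + suc k * z) * c                   ∎)
  where
  open ≤-Reasoning
  c : ℕ
  c = m C k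
  c′ : ℕ
  c′ = m C suc k
  expandˡ : ∀ K x y c → K * (x + y) * c ≡ K * (x * c) + y * (K * c)
  expandˡ = solve-∀
  expandʳ : ∀ K y z c c′ → K * (y * c′ + z * c) + y * (K * c) ≡ y * (K * c′ + K * c) + K * z * c
  expandʳ = solve-∀
  collect : ∀ y M K z c → y * (M * c) + K * z * c ≡ (y * M + K * z) * c
  collect = solve-∀

C-ratio-≤₁ : ∀ {m k} x → k ≤ m → x * (m C k) ≤ m C suc k → suc k * (x + 1) ≤ suc m
C-ratio-≤₁ {m} {k} x k≤m hyp = subst (suc k * (x + 1) ≤_) (unit (suc m) (suc k))
  (C-ratio-≤ x 1 0 k≤m (subst (x * (m C k) ≤_) (sym (unit (m C suc k) 0)) hyp))
  where
  unit : ∀ u v → 1 * u + v * 0 ≡ u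
  unit = solve-∀

C-ratio-≥ : ∀ {m k} x → k ≤ m → m C suc k ≤ x * (m C k) → suc m ≤ suc k * (x + 1)
C-ratio-≥ {m} {k} x k≤m hyp = *-cancelʳ-≤ _ _ c {{>-nonZero (C-pos k≤m)}} (begin
  suc m * c                        ≡⟨ sym (C-step m k) ⟩
  suc k * (m C suc k) + suc k * c  ≤⟨ +-monoˡ-≤ (suc k * c) (*-monoʳ-≤ (suc k) hyp) ⟩
  suc k * (x * c) + suc k * c      ≡⟨ collect (suc k) x c ⟩
  suc k * (x + 1) * c              ∎)
  where
  open ≤-Reasoning
  c : ℕ
  c = m C k
  collect : ∀ K x c → K * (x * c) + K * c ≡ K * (x + 1) * c
  collect = solve-∀

-- Occurrences of 1(l+1)l…2 whose top l entries lie in one layer of a layered permutation with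
-- layer sizes cs (bottom to top) and whose 1 lies in an earlier layer or among a further a entries
-- below all layers.
layeredCount : ℕ → ℕ → List ℕ → ℕ
layeredCount l a []       = 0
layeredCount l a (c ∷ cs) = a * (c C l) + layeredCount l (a + c) cs

layeredCount-++ : ∀ l a xs ys →
  layeredCount l a (xs ++ ys) ≡ layeredCount l a xs + layeredCount l (a + sum xs) ys
layeredCount-++ l a []       ys = cong (λ t → layeredCount l t ys) (sym (+-identityʳ a))
layeredCount-++ l a (c ∷ xs) ys = begin
  a * (c C l) + layeredCount l (a + c) (xs ++ ys)
    ≡⟨ cong (a * (c C l) +_) (layeredCount-++ l (a + c) xs ys) ⟩
  a * (c C l) + (layeredCount l (a + c) xs + layeredCount l (a + c + sum xs) ys)
    ≡⟨ sym (+-assoc (a * (c C l)) _ _) ⟩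
  a * (c C l) + layeredCount l (a + c) xs + layeredCount l (a + c + sum xs) ys
    ≡⟨ cong (λ t → a * (c C l) + layeredCount l (a + c) xs + layeredCount l t ys) (+-assoc a c (sum xs)) ⟩
  a * (c C l) + layeredCount l (a + c) xs + layeredCount l (a + (c + sum xs)) ys
    ∎
  where open ≡-Reasoning

layeredCount-shift : ∀ l a d cs → layeredCount l (a + d) cs ≡ layeredCount l a cs + d * sum (map (_C l) cs)
layeredCount-shift l a d []       = sym (*-zeroʳ d)
layeredCount-shift l a d (c ∷ cs) = begin
  (a + d) * (c C l) + layeredCount l (a + d + c) cs
    ≡⟨ cong₂ _+_ (*-distribʳ-+ (c C l) a d) (cong (λ t → layeredCount l t cs) (+-comm-inner a d c)) ⟩
  (a * (c C l) + d * (c C l)) + layeredCount l (a + c + d) cs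
    ≡⟨ cong ((a * (c C l) + d * (c C l)) +_) (layeredCount-shift l (a + c) d cs) ⟩
  (a * (c C l) + d * (c C l)) + (layeredCount l (a + c) cs + d * sum (map (_C l) cs))
    ≡⟨ regroup (a * (c C l)) d (c C l) (layeredCount l (a + c) cs) (sum (map (_C l) cs)) ⟩
  (a * (c C l) + layeredCount l (a + c) cs) + d * (c C l + sum (map (_C l) cs))
    ∎
  where
  open ≡-Reasoning
  +-comm-inner : ∀ a d c → a + d + c ≡ a + c + d
  +-comm-inner = solve-∀
  regroup : ∀ p d x q s → (p + d * x) + (q + d * s) ≡ (p + q) + d * (x + s)
  regroup = solve-∀

layeredCount-zero : ∀ l a cs → sum (map (_C l) cs) ≡ 0 → layeredCount l a cs ≡ 0
layeredCount-zero l a []       _  = refl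
layeredCount-zero l a (c ∷ cs) S≡0 = cong₂ _+_
  (trans (cong (a *_) (m+n≡0⇒m≡0 (c C l) S≡0)) (*-zeroʳ a))
  (layeredCount-zero l (a + c) cs (m+n≡0⇒n≡0 (c C l) S≡0))

layeredCount-pair : ∀ l a x y → layeredCount l a (x ∷ y ∷ []) ≡ a * (x C l + y C l) + x * (y C l)
layeredCount-pair l a x y = expand a x (x C l) (y C l)
  where
  expand : ∀ a x X Y → a * X + ((a + x) * Y + 0) ≡ a * (X + Y) + x * Y
  expand = solve-∀

AllPairs-resp-⊆ : ∀ {R : ℕ → ℕ → Set} {xs ys} → xs ⊆ ys → AllPairs R ys → AllPairs R xs
AllPairs-resp-⊆ []          []         = []
AllPairs-resp-⊆ (_ ∷ʳ xs⊆)  (_ ∷ rys)  = AllPairs-resp-⊆ xs⊆ rys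
AllPairs-resp-⊆ (refl ∷ xs⊆) (ry ∷ rys) = All-resp-⊆ xs⊆ ry ∷ AllPairs-resp-⊆ xs⊆ rys

countBy : (List ℕ → Bool) → ℕ → List ℕ → ℕ
countBy g k xs = sum (map (λ s → if g s then 1 else 0) (subseqs k xs))

countBy-∷ : ∀ g k x xs →
  countBy g (suc k) (x ∷ xs) ≡ countBy (λ s → g (x ∷ s)) k xs + countBy g (suc k) xs
countBy-∷ g k x xs = begin
  sum (map f (map (x ∷_) (subseqs k xs) ++ subseqs (suc k) xs))
    ≡⟨ cong sum (map-++ f (map (x ∷_) (subseqs k xs)) (subseqs (suc k) xs)) ⟩
  sum (map f (map (x ∷_) (subseqs k xs)) ++ map f (subseqs (suc k) xs))
    ≡⟨ sum-++ (map f (map (x ∷_) (subseqs k xs))) (map f (subseqs (suc k) xs)) ⟩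
  sum (map f (map (x ∷_) (subseqs k xs))) + countBy g (suc k) xs
    ≡⟨ cong (λ t → sum t + countBy g (suc k) xs) (sym (map-∘ (subseqs k xs))) ⟩
  countBy (λ s → g (x ∷ s)) k xs + countBy g (suc k) xs
    ∎
  where
  open ≡-Reasoning
  f : List ℕ → ℕ
  f = λ s → if g s then 1 else 0

countBy-none : ∀ g k ys → (∀ {s} → s ⊆ ys → length s ≡ k → g s ≡ false) → countBy g k ys ≡ 0
countBy-none g zero ys rejected rewrite rejected (minimum ys) refl = refl
countBy-none g (suc k) [] rejected = refl
countBy-none g (suc k) (y ∷ ys) rejected = trans (countBy-∷ g k y ys) (cong₂ _+_
  (countBy-none _ k ys (λ s⊆ e → rejected (refl ∷ s⊆) (cong suc e)))
  (countBy-none g (suc k) ys (λ s⊆ e → rejected (y ∷ʳ s⊆) e)))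

countBy-all : ∀ g k ys → (∀ {s} → s ⊆ ys → length s ≡ k → g s ≡ true) →
  countBy g k ys ≡ length ys C k
countBy-all g zero ys accepted rewrite accepted (minimum ys) refl = refl
countBy-all g (suc k) [] accepted = refl
countBy-all g (suc k) (y ∷ ys) accepted = trans (countBy-∷ g k y ys) (trans (cong₂ _+_
  (countBy-all _ k ys (λ s⊆ e → accepted (refl ∷ s⊆) (cong suc e)))
  (countBy-all g (suc k) ys (λ s⊆ e → accepted (y ∷ʳ s⊆) e)))
  (nCk+nC[k+1]≡[n+1]C[k+1] (length ys) k))

countBy-++-ignoreʳ : ∀ g k xs ys →
  (∀ {s y t} → s ⊆ xs → y ∷ t ⊆ ys → length (s ++ y ∷ t) ≡ k → g (s ++ y ∷ t) ≡ false) →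
  countBy g k (xs ++ ys) ≡ countBy g k xs
countBy-++-ignoreʳ g zero xs ys rejected = refl
countBy-++-ignoreʳ g (suc k) [] ys rejected = countBy-none g (suc k) ys rejected′
  where
  rejected′ : ∀ {s} → s ⊆ ys → length s ≡ suc k → g s ≡ false
  rejected′ {y ∷ t} yt⊆ys e = rejected (minimum []) yt⊆ys e
countBy-++-ignoreʳ g (suc k) (x ∷ xs) ys rejected = begin
  countBy g (suc k) (x ∷ xs ++ ys)
    ≡⟨ countBy-∷ g k x (xs ++ ys) ⟩
  countBy (λ s → g (x ∷ s)) k (xs ++ ys) + countBy g (suc k) (xs ++ ys)
    ≡⟨ cong₂ _+_
         (countBy-++-ignoreʳ _ k xs ys (λ s⊆ yt⊆ e → rejected (refl ∷ s⊆) yt⊆ (cong suc e)))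
                 (countBy-++-ignoreʳ g (suc k) xs ys (λ s⊆ → rejected (x ∷ʳ s⊆))) ⟩
  countBy (λ s → g (x ∷ s)) k xs + countBy g (suc k) xs
    ≡⟨ sym (countBy-∷ g k x xs) ⟩
  countBy g (suc k) (x ∷ xs)
    ∎
  where open ≡-Reasoning

countBy-++ : ∀ g k xs ys →
  (∀ {x s y t} → x ∷ s ⊆ xs → y ∷ t ⊆ ys → length (x ∷ s ++ y ∷ t) ≡ suc k →
                 g (x ∷ s ++ y ∷ t) ≡ false) →
  countBy g (suc k) (xs ++ ys) ≡ countBy g (suc k) xs + countBy g (suc k) ys
countBy-++ g k [] ys rejected = refl
countBy-++ g k (x ∷ xs) ys rejected = begin
  countBy g (suc k) (x ∷ xs ++ ys)
    ≡⟨ countBy-∷ g k x (xs ++ ys) ⟩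
  countBy (λ s → g (x ∷ s)) k (xs ++ ys) + countBy g (suc k) (xs ++ ys)
    ≡⟨ cong₂ _+_
         (countBy-++-ignoreʳ _ k xs ys (λ s⊆ yt⊆ e → rejected (refl ∷ s⊆) yt⊆ (cong suc e)))
                 (countBy-++ g k xs ys (λ xs⊆ → rejected (x ∷ʳ xs⊆))) ⟩
  countBy (λ s → g (x ∷ s)) k xs + (countBy g (suc k) xs + countBy g (suc k) ys)
    ≡⟨ sym (+-assoc (countBy (λ s → g (x ∷ s)) k xs) _ _) ⟩
  countBy (λ s → g (x ∷ s)) k xs + countBy g (suc k) xs + countBy g (suc k) ys
    ≡⟨ cong (_+ countBy g (suc k) ys) (sym (countBy-∷ g k x xs)) ⟩
  countBy g (suc k) (x ∷ xs) + countBy g (suc k) ys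
    ∎
  where open ≡-Reasoning

<ᵇ-true : ∀ {x y} → x < y → (x <ᵇ y) ≡ true
<ᵇ-true {zero}  {suc y} _       = refl
<ᵇ-true {suc x} {suc y} (s≤s p) = <ᵇ-true p

<ᵇ-false : ∀ {x y} → y ≤ x → (x <ᵇ y) ≡ false
<ᵇ-false {x}     {zero}  _       = refl
<ᵇ-false {suc x} {suc y} (s≤s p) = <ᵇ-false p

-- Definitionally the pairwise test inside orderIso, so lemmas about it rewrite orderIso goals.
agree : ℕ → ℕ → ℕ × ℕ → Bool
agree x y (u , v) = ((x <ᵇ u) == (y <ᵇ v)) ∧ ((u <ᵇ x) == (v <ᵇ y))

agree-above : ∀ {x y} s ws → All (x <_) s → All (y <_) ws → and (map (agree x y) (zip s ws)) ≡ true
agree-above []      _        _          _          = refl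
agree-above (_ ∷ _) []       _          _          = refl
agree-above (u ∷ s) (v ∷ ws) (x<u ∷ x<s) (y<v ∷ y<ws)
  rewrite <ᵇ-true x<u | <ᵇ-true y<v | <ᵇ-false (<⇒≤ x<u) | <ᵇ-false (<⇒≤ y<v) =
  agree-above s ws x<s y<ws

agree-below : ∀ {x y} s ws → All (_< x) s → All (_< y) ws → and (map (agree x y) (zip s ws)) ≡ true
agree-below []      _        _          _          = refl
agree-below (_ ∷ _) []       _          _          = refl
agree-below (u ∷ s) (v ∷ ws) (u<x ∷ s<x) (v<y ∷ ws<y)
  rewrite <ᵇ-true u<x | <ᵇ-true v<y | <ᵇ-false (<⇒≤ u<x) | <ᵇ-false (<⇒≤ v<y) =
  agree-below s ws s<x ws<y

agree-crossing : ∀ {x y u} s t ws → x < u → All (_< y) ws → length (s ++ u ∷ t) ≡ length ws →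
  and (map (agree x y) (zip (s ++ u ∷ t) ws)) ≡ false
agree-crossing []      t (v ∷ ws) x<u (v<y ∷ _) _
  rewrite <ᵇ-true x<u | <ᵇ-false (<⇒≤ v<y) = refl
agree-crossing (w ∷ s) t (v ∷ ws) x<u (_ ∷ ws<y) e =
  trans (cong (agree _ _ (w , v) ∧_) (agree-crossing s t ws x<u ws<y (suc-injective e))) (∧-zeroʳ _)

orderIso-descending : ∀ s ws → AllPairs _>_ s → AllPairs _>_ ws → length s ≡ length ws →
  orderIso s ws ≡ true
orderIso-descending []      []       _          _            _ = refl
orderIso-descending (u ∷ s) (v ∷ ws) (s<u ∷ ds) (ws<v ∷ dws) e
  = trans (cong (_∧ orderIso s ws) (agree-below s ws s<u ws<v)) (orderIso-descending s ws ds dws (suc-injective e))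

matchesQ : ℕ → List ℕ → Bool
matchesQ j s = orderIso s (qpat (suc j))

countQ : ℕ → List ℕ → ℕ
countQ j = countBy (matchesQ j) (suc (suc j))

qtail-length : ∀ n → length (map suc (downFrom n)) ≡ n
qtail-length n = trans (length-map suc (downFrom n)) (length-downFrom n)

qtail-descending : ∀ n → AllPairs _>_ (map suc (downFrom n))
qtail-descending n = AllPairs.map⁺ (AllPairs.applyDownFrom⁺₁ id n (λ j<i _ → s≤s j<i))

qtail-positive : ∀ n → All (0 <_) (map suc (downFrom n))
qtail-positive n = All.map⁺ (All.applyDownFrom⁺₂ id n (λ _ → s≤s z≤n))

qtail-bounded : ∀ n → All (_< suc n) (map suc (downFrom n))
qtail-bounded n = All.map⁺ (All.applyDownFrom⁺₁ id n s≤s)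

count≡countQ : ∀ j p → count (qpat (suc j)) p ≡ countQ j p
count≡countQ j p = cong (λ k → countBy (matchesQ j) (suc k) p) (qtail-length (suc j))

q-match : ∀ j {x} s → All (x <_) s → AllPairs _>_ s → length s ≡ suc j → matchesQ j (x ∷ s) ≡ true
q-match j s x<s ds e = trans
  (cong (_∧ orderIso s ws) (agree-above s ws x<s (qtail-positive (suc j))))
  (orderIso-descending s ws ds (qtail-descending (suc j)) (trans e (sym (qtail-length (suc j)))))
  where
  ws : List ℕ
  ws = map suc (downFrom (suc j))

q-ascent : ∀ j x {c u} s t → c < u → length (c ∷ s ++ u ∷ t) ≡ suc j →
  matchesQ j (x ∷ c ∷ s ++ u ∷ t) ≡ false
q-ascent j x {c} {u} s t c<u e = trans
  (cong (λ b → head ∧ (b ∧ orderIso (s ++ u ∷ t) ws))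
        (agree-crossing s t ws c<u (qtail-bounded j) (trans (suc-injective e) (sym (qtail-length j)))))
  (∧-zeroʳ head)
  where
  ws : List ℕ
  ws = map suc (downFrom j)
  head : Bool
  head = and (map (agree x 0) (zip (c ∷ s ++ u ∷ t) (suc j ∷ ws)))

q-descent : ∀ j {a b} r → b < a → matchesQ j (a ∷ b ∷ r) ≡ false
q-descent j r b<a rewrite <ᵇ-false (<⇒≤ b<a) = refl

Below : List ℕ → List ℕ → Set
Below xs ys = All (λ x → All (x <_) ys) xs

-- An occurrence meeting L has its 1 in xs and its l top entries in L: q starts with an ascent, and
-- an occurrence taking top entries from both xs and L would contain a forbidden ascent.
countQ-++-layer : ∀ j xs L → AllPairs _>_ L → Below xs L →
  countQ j (xs ++ L) ≡ countQ j xs + length xs * (length L C suc j)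
countQ-++-layer j [] L dL _ = countBy-none (matchesQ j) (suc (suc j)) L noPattern
  where
  noPattern : ∀ {s} → s ⊆ L → length s ≡ suc (suc j) → matchesQ j s ≡ false
  noPattern {a ∷ b ∷ r} s⊆L _ with AllPairs-resp-⊆ s⊆L dL
  ... | (b<a ∷ _) ∷ _ = q-descent j r b<a
countQ-++-layer j (x ∷ xs) L dL (x<L ∷ xs<L) = begin
    countQ j (x ∷ xs ++ L)
  ≡⟨ countBy-∷ (matchesQ j) (suc j) x (xs ++ L) ⟩
    countBy startX (suc j) (xs ++ L) + countQ j (xs ++ L)
  ≡⟨ cong₂ _+_ (countBy-++ startX j xs L ascent) (countQ-++-layer j xs L dL xs<L) ⟩
    (countBy startX (suc j) xs + countBy startX (suc j) L) + (countQ j xs + length xs * c)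
  ≡⟨ cong (λ t → (countBy startX (suc j) xs + t) + (countQ j xs + length xs * c))
          (countBy-all startX (suc j) L match) ⟩
    (countBy startX (suc j) xs + c) + (countQ j xs + length xs * c)
  ≡⟨ +-interchange (countBy startX (suc j) xs) c (countQ j xs) (length xs * c) ⟩
    (countBy startX (suc j) xs + countQ j xs) + (c + length xs * c)
  ≡⟨ cong (_+ (c + length xs * c)) (sym (countBy-∷ (matchesQ j) (suc j) x xs)) ⟩
    countQ j (x ∷ xs) + suc (length xs) * c
  ∎
  where
  open ≡-Reasoning
  startX : List ℕ → Bool
  startX = λ s → matchesQ j (x ∷ s)
  c : ℕ
  c = length L C suc j
  match : ∀ {s} → s ⊆ L → length s ≡ suc j → startX s ≡ true
  match s⊆L e = q-match j _ (All-resp-⊆ s⊆L x<L) (AllPairs-resp-⊆ s⊆L dL) e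
  ascent : ∀ {y s u t} → y ∷ s ⊆ xs → u ∷ t ⊆ L → length (y ∷ s ++ u ∷ t) ≡ suc j →
           startX (y ∷ s ++ u ∷ t) ≡ false
  ascent {s = s} {t = t} ys⊆xs ut⊆L e with All-resp-⊆ ys⊆xs xs<L
  ... | y<L ∷ _ with All-resp-⊆ ut⊆L y<L
  ...   | y<u ∷ _ = q-ascent j x s t y<u e

countQ-++-layers : ∀ j xs Ls → All (AllPairs _>_) Ls → AllPairs Below Ls → Below xs (concat Ls) →
  countQ j (xs ++ concat Ls) ≡ countQ j xs + layeredCount (suc j) (length xs) (map length Ls)
countQ-++-layers j xs [] _ _ _ = trans (cong (countQ j) (++-identityʳ xs)) (sym (+-identityʳ _))
countQ-++-layers j xs (L ∷ Ls) (dL ∷ dLs) (L<Ls ∷ Ls-below) xs<L++Ls = begin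
    countQ j (xs ++ L ++ concat Ls)
  ≡⟨ cong (countQ j) (sym (++-assoc xs L (concat Ls))) ⟩
    countQ j ((xs ++ L) ++ concat Ls)
  ≡⟨ countQ-++-layers j (xs ++ L) Ls dLs Ls-below xsL<Ls ⟩
    countQ j (xs ++ L) + layeredCount (suc j) (length (xs ++ L)) (map length Ls)
  ≡⟨ cong₂ _+_ (countQ-++-layer j xs L dL (All.map (All.++⁻ˡ L) xs<L++Ls))
               (cong (λ a → layeredCount (suc j) a (map length Ls)) (length-++ xs)) ⟩
    (countQ j xs + length xs * (length L C suc j)) + layeredCount (suc j) (length xs + length L) (map length Ls)
  ≡⟨ +-assoc (countQ j xs) _ _ ⟩
    countQ j xs + layeredCount (suc j) (length xs) (map length (L ∷ Ls))
  ∎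
  where
  open ≡-Reasoning
  xsL<Ls : Below (xs ++ L) (concat Ls)
  xsL<Ls = All.++⁺ (All.map (All.++⁻ʳ L) xs<L++Ls) (All.map All.concat⁺ (All.All-swap L<Ls))

count-layered : ∀ j Ls → All Decreasing Ls → AllPairs Below Ls →
  count (qpat (suc j)) (concat Ls) ≡ layeredCount (suc j) 0 (map length Ls)
count-layered j Ls decreasing below = trans (count≡countQ j (concat Ls))
  (countQ-++-layers j [] Ls (All.map (Linked.Linked⇒AllPairs (λ y<x z<y → <-trans z<y y<x)) decreasing) below [])

blocks : (ℕ → ℕ) → List ℕ → List (List ℕ)
blocks f []       = []
blocks f (c ∷ cs) = applyDownFrom f c ∷ blocks (λ i → f (c + i)) cs

f0≤f : ∀ {f} → Monotonic₁ _<_ _<_ f → ∀ i → f 0 ≤ f i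
f0≤f f↑ zero    = ≤-refl
f0≤f f↑ (suc i) = <⇒≤ (f↑ (s≤s z≤n))

shift-increasing : ∀ {f} c → Monotonic₁ _<_ _<_ f → Monotonic₁ _<_ _<_ (λ i → f (c + i))
shift-increasing c f↑ i<j = f↑ (+-monoʳ-< c i<j)

applyUpTo-+ : ∀ (f : ℕ → ℕ) m n → applyUpTo f (m + n) ≡ applyUpTo f m ++ applyUpTo (λ i → f (m + i)) n
applyUpTo-+ f zero    n = refl
applyUpTo-+ f (suc m) n = cong (f 0 ∷_) (applyUpTo-+ (λ i → f (suc i)) m n)

concat-blocks↭ : ∀ f cs → concat (blocks f cs) ↭ applyUpTo f (sum cs)
concat-blocks↭ f []       = ↭-refl
concat-blocks↭ f (c ∷ cs) = ↭-trans
  (Perm.++⁺ (subst (_↭ applyUpTo f c) (reverse-applyUpTo f c) (Perm.↭-reverse (applyUpTo f c)))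
            (concat-blocks↭ (λ i → f (c + i)) cs))
  (↭-reflexive (sym (applyUpTo-+ f c (sum cs))))

blocks-lengths : ∀ f cs → map length (blocks f cs) ≡ cs
blocks-lengths f []       = refl
blocks-lengths f (c ∷ cs) = cong₂ _∷_ (length-applyDownFrom f c) (blocks-lengths (λ i → f (c + i)) cs)

blocks-decreasing : ∀ {f} cs → Monotonic₁ _<_ _<_ f → All Decreasing (blocks f cs)
blocks-decreasing {f} []       f↑ = []
blocks-decreasing {f} (c ∷ cs) f↑ =
  Linked.applyDownFrom⁺₂ f c (λ i → f↑ (n<1+n i)) ∷ blocks-decreasing cs (shift-increasing c f↑)

blocks-bounded : ∀ {f} cs → Monotonic₁ _<_ _<_ f → All (All (f 0 ≤_)) (blocks f cs)
blocks-bounded {f} []       f↑ = []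
blocks-bounded {f} (c ∷ cs) f↑ =
  All.applyDownFrom⁺₂ f c (f0≤f f↑) ∷
  All.map (All.map (≤-trans (f0≤f f↑ (c + 0)))) (blocks-bounded cs (shift-increasing c f↑))

blocks-below : ∀ {f} cs → Monotonic₁ _<_ _<_ f → AllPairs Below (blocks f cs)
blocks-below {f} []       f↑ = []
blocks-below {f} (c ∷ cs) f↑ =
  All.map (λ later≥ → All.map (λ x<fc → All.map (<-≤-trans x<fc) later≥) block<fc) laterBounds
  ∷ blocks-below cs (shift-increasing c f↑)
  where
  block<fc : All (_< f c) (applyDownFrom f c)
  block<fc = All.applyDownFrom⁺₁ f c f↑
  laterBounds : All (All (f c ≤_)) (blocks (λ i → f (c + i)) cs)
  laterBounds = All.map (All.map (≤-trans (≤-reflexive (cong f (sym (+-identityʳ c))))))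
                        (blocks-bounded cs (shift-increasing c f↑))

count-blocks : ∀ j cs → count (qpat (suc j)) (concat (blocks id cs)) ≡ layeredCount (suc j) 0 cs
count-blocks j cs = trans
  (count-layered j (blocks id cs) (blocks-decreasing cs id) (blocks-below cs id))
  (cong (layeredCount (suc j) 0) (blocks-lengths id cs))

length-concat : ∀ (Ls : List (List ℕ)) → length (concat Ls) ≡ sum (map length Ls)
length-concat []       = refl
length-concat (L ∷ Ls) = trans (length-++ L) (cong (length L +_) (length-concat Ls))

layers-total : ∀ {n Ls p} → Layers Ls p → IsPerm n p → sum (map length Ls) ≡ n
layers-total {n} {Ls} (concat≡p , _) perm = trans (sym (length-concat Ls))
  (trans (cong length concat≡p) (trans (Perm.↭-length perm) (length-upTo n)))

CompositionOptimal : ℕ → List ℕ → Set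
CompositionOptimal l cs = ∀ cs′ → sum cs′ ≡ sum cs → layeredCount l 0 cs′ ≤ layeredCount l 0 cs

optimal⇒compositionOptimal : ∀ {j n Ls p} → Layers Ls p → Optimal (qpat (suc j)) n p →
  CompositionOptimal (suc j) (map length Ls)
optimal⇒compositionOptimal {j} {n} {Ls} {p}
  layers@(concat≡p , _ , decreasing , below) (perm , best) cs′ sum≡ = begin
  layeredCount (suc j) 0 cs′              ≡⟨ sym (count-blocks j cs′) ⟩
  count q p′                              ≤⟨ best p′ p′-perm ⟩
  count q p                               ≡⟨ cong (count q) (sym concat≡p) ⟩
  count q (concat Ls)                     ≡⟨ count-layered j Ls decreasing below ⟩
  layeredCount (suc j) 0 (map length Ls)  ∎
  where
  open ≤-Reasoning
  q : List ℕ
  q = qpat (suc j)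
  p′ : List ℕ
  p′ = concat (blocks id cs′)
  p′-perm : IsPerm n p′
  p′-perm = subst (λ N → IsPerm N p′) (trans sum≡ (layers-total layers perm)) (concat-blocks↭ id cs′)

compositionOptimal⇒0<count : ∀ {l} cs → suc l ≤ sum cs → CompositionOptimal l cs → 0 < layeredCount l 0 cs
compositionOptimal⇒0<count {l} cs l<N opt = <-≤-trans (C-pos (∸-monoˡ-≤ 1 l<N)) (begin
  (sum cs ∸ 1) C l                           ≡⟨ sym (trans (+-identityʳ _) (+-identityʳ _)) ⟩
  layeredCount l 0 (1 ∷ (sum cs ∸ 1) ∷ [])   ≤⟨ opt (1 ∷ (sum cs ∸ 1) ∷ []) sums ⟩
  layeredCount l 0 cs                        ∎)
  where
  open ≤-Reasoning
  sums : 1 + ((sum cs ∸ 1) + 0) ≡ sum cs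
  sums = trans (cong suc (+-identityʳ _)) (m+[n∸m]≡n (≤-trans (s≤s z≤n) l<N))

-- If m < l the last layer contributes nothing, so moving it to the bottom would gain m·Σᵢ C(cᵢ,l);
-- optimality forces every C(cᵢ,l) to vanish, contradicting a positive count.
compositionOptimal⇒l≤last : ∀ {l} cs m → suc l ≤ sum (cs ++ m ∷ []) → 0 < m →
  CompositionOptimal l (cs ++ m ∷ []) → l ≤ m
compositionOptimal⇒l≤last {l} cs m l<N 0<m opt with l ≤? m
... | yes l≤m = l≤m
... | no l≰m = contradiction (trans collapse (layeredCount-zero l 0 cs S≡0))
                             (>⇒≢ (compositionOptimal⇒0<count (cs ++ m ∷ []) l<N opt))
  where
  S : ℕ
  S = sum (map (_C l) cs)
  collapse : layeredCount l 0 (cs ++ m ∷ []) ≡ layeredCount l 0 cs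
  collapse = begin
    layeredCount l 0 (cs ++ m ∷ [])               ≡⟨ layeredCount-++ l 0 cs (m ∷ []) ⟩
    layeredCount l 0 cs + (sum cs * (m C l) + 0)  ≡⟨ cong (λ t → layeredCount l 0 cs + (sum cs * t + 0))
                                                          (k>n⇒nCk≡0 (≰⇒> l≰m)) ⟩
    layeredCount l 0 cs + (sum cs * 0 + 0)        ≡⟨ cong (λ t → layeredCount l 0 cs + (t + 0))
                                                          (*-zeroʳ (sum cs)) ⟩
    layeredCount l 0 cs + 0                       ≡⟨ +-identityʳ _ ⟩
    layeredCount l 0 cs                           ∎
    where open ≡-Reasoning
  rotated : sum (m ∷ cs) ≡ sum (cs ++ m ∷ [])
  rotated = trans (+-comm m (sum cs)) (trans (cong (sum cs +_) (sym (+-identityʳ m))) (sym (sum-++ cs (m ∷ []))))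
  m*S≤0 : m * S ≤ 0
  m*S≤0 = +-cancelˡ-≤ (layeredCount l 0 cs) _ _ (begin
    layeredCount l 0 cs + m * S      ≡⟨ sym (layeredCount-shift l 0 m cs) ⟩
    layeredCount l 0 (m ∷ cs)        ≤⟨ opt (m ∷ cs) rotated ⟩
    layeredCount l 0 (cs ++ m ∷ [])  ≡⟨ collapse ⟩
    layeredCount l 0 cs              ≡⟨ sym (+-identityʳ _) ⟩
    layeredCount l 0 cs + 0          ∎)
    where open ≤-Reasoning
  S≡0 : S ≡ 0
  S≡0 = n≤0⇒n≡0 (≤-trans (m≤n*m S m {{>-nonZero 0<m}}) m*S≤0)

TopTwoOptimal : ℕ → ℕ → ℕ → ℕ → Set
TopTwoOptimal l a b m = ∀ cs → sum cs ≡ b + m → layeredCount l a cs ≤ layeredCount l a (b ∷ m ∷ [])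

compositionOptimal⇒topTwoOptimal : ∀ {l} cs b m → CompositionOptimal l (cs ++ b ∷ m ∷ []) →
  TopTwoOptimal l (sum cs) b m
compositionOptimal⇒topTwoOptimal {l} cs b m opt cs′ sum≡ = +-cancelˡ-≤ (layeredCount l 0 cs) _ _ (begin
  layeredCount l 0 cs + layeredCount l (sum cs) cs′           ≡⟨ sym (layeredCount-++ l 0 cs cs′) ⟩
  layeredCount l 0 (cs ++ cs′)                                ≤⟨ opt (cs ++ cs′) sums ⟩
  layeredCount l 0 (cs ++ b ∷ m ∷ [])                         ≡⟨ layeredCount-++ l 0 cs (b ∷ m ∷ []) ⟩
  layeredCount l 0 cs + layeredCount l (sum cs) (b ∷ m ∷ [])  ∎)
  where
  open ≤-Reasoning
  sums : sum (cs ++ cs′) ≡ sum (cs ++ b ∷ m ∷ [])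
  sums = trans (sum-++ cs cs′)
           (trans (cong (sum cs +_) (trans sum≡ (cong (b +_) (sym (+-identityʳ m)))))
                  (sym (sum-++ cs (b ∷ m ∷ []))))

topTwoOptimal⇒b≤m : ∀ {j a b m} → suc (suc j) ≤ m → TopTwoOptimal (suc (suc j)) a b m → b ≤ m
topTwoOptimal⇒b≤m {j} {a} {b} {m} l≤m opt with b ≤? m
... | yes b≤m = b≤m
... | no b≰m = contradiction swapped (<⇒≱ (C/n-mono-< (≤-trans (n≤1+n (suc j)) l≤m) (≰⇒> b≰m)))
  where
  open ≤-Reasoning
  l : ℕ
  l = suc (suc j)
  swapped : m * (b C l) ≤ b * (m C l)
  swapped = +-cancelˡ-≤ (a * (b C l + m C l)) _ _ (begin
    a * (b C l + m C l) + m * (b C l) ≡⟨ cong (λ t → a * t + m * (b C l)) (+-comm (b C l) (m C l)) ⟩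
    a * (m C l + b C l) + m * (b C l) ≡⟨ sym (layeredCount-pair l a m b) ⟩
    layeredCount l a (m ∷ b ∷ [])     ≤⟨ opt (m ∷ b ∷ []) (trans (cong (m +_) (+-identityʳ b)) (+-comm m b)) ⟩
    layeredCount l a (b ∷ m ∷ [])     ≡⟨ layeredCount-pair l a b m ⟩
    a * (b C l + m C l) + b * (m C l) ∎)

topTwoOptimal⇒la+l≤m+1 : ∀ {j a b m} → 0 < b → suc j ≤ m → TopTwoOptimal (suc (suc j)) a b m →
  suc (suc j) * a + suc (suc j) ≤ m + 1
topTwoOptimal⇒la+l≤m+1 {j} {a} {b} {m} 0<b j<m opt =
  subst₂ _≤_ (trans (*-distribˡ-+ l a 1) (cong (l * a +_) (*-identityʳ l))) (+-comm 1 m)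
    (C-ratio-≤₁ a j<m (*-cancelˡ-≤ b {{>-nonZero 0<b}} (begin
      b * (a * (m C suc j)) ≡⟨ x∙yz≈y∙xz b a (m C suc j) ⟩
      a * (b * (m C suc j)) ≤⟨ +-cancelˡ-≤ (a * (b C l + m C l)) _ _ merged ⟩
      b * (m C l)           ∎)))
  where
  open ≤-Reasoning
  l : ℕ
  l = suc (suc j)
  merged : a * (b C l + m C l) + a * (b * (m C suc j)) ≤ a * (b C l + m C l) + b * (m C l)
  merged = begin
    a * (b C l + m C l) + a * (b * (m C suc j)) ≡⟨ sym (*-distribˡ-+ a (b C l + m C l) _) ⟩
    a * (b C l + m C l + b * (m C suc j))       ≤⟨ *-monoʳ-≤ a (C-+-lowerBound b m j) ⟩
    a * ((b + m) C l)                           ≡⟨ sym (+-identityʳ _) ⟩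
    layeredCount l a ((b + m) ∷ [])             ≤⟨ opt ((b + m) ∷ []) (+-identityʳ (b + m)) ⟩
    layeredCount l a (b ∷ m ∷ [])               ≡⟨ layeredCount-pair l a b m ⟩
    a * (b C l + m C l) + b * (m C l)           ∎

-- Compares with moving one entry from the penultimate layer to the last.
topTwoOptimal⇒transfer-bound : ∀ {j a d m} → TopTwoOptimal (suc (suc j)) a (suc d) m →
  (a + d) * (m C suc j) ≤ a * (d C suc j) + m C suc (suc j)
topTwoOptimal⇒transfer-bound {j} {a} {d} {m} opt = +-cancelˡ-≤ (a * (d C l) + a * c + d * c) _ _ (begin
  a * (d C l) + a * c + d * c + (a + d) * c′  ≡⟨ sym (lhs a d (d C l) c′ c) ⟩
  a * (d C l + (c′ + c)) + d * (c′ + c)      ≡⟨ cong (λ t → a * (d C l + t) + d * t)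
                                                   (sym (C-pascal m (suc j))) ⟩
  a * (d C l + suc m C l) + d * (suc m C l)  ≡⟨ sym (layeredCount-pair l a d (suc m)) ⟩
  layeredCount l a (d ∷ suc m ∷ [])          ≤⟨ opt (d ∷ suc m ∷ [])
                                                   (trans (cong (d +_) (+-identityʳ _)) (+-suc d m)) ⟩
  layeredCount l a (suc d ∷ m ∷ [])          ≡⟨ layeredCount-pair l a (suc d) m ⟩
  a * (suc d C l + c) + suc d * c            ≡⟨ cong (λ t → a * (t + c) + suc d * c) (C-pascal d (suc j)) ⟩
  a * ((d C suc j + d C l) + c) + suc d * c  ≡⟨ rhs a d (d C l) c (d C suc j) ⟩
  a * (d C l) + a * c + d * c + (a * (d C suc j) + c) ∎)
  where
  open ≤-Reasoning
  l : ℕ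
  l = suc (suc j)
  c : ℕ
  c = m C l
  c′ : ℕ
  c′ = m C suc j
  lhs : ∀ a d x y z → a * (x + (y + z)) + d * (y + z) ≡ a * x + a * z + d * z + (a + d) * y
  lhs = solve-∀
  rhs : ∀ a d x z w → a * ((w + x) + z) + suc d * z ≡ a * x + a * z + d * z + (a * w + z)
  rhs = solve-∀

topTwoOptimal⇒lb≤m+1 : ∀ {j a d m} → suc (suc j) ≤ m → TopTwoOptimal (suc (suc j)) a (suc d) m →
  suc (suc j) * suc d ≤ suc m
topTwoOptimal⇒lb≤m+1 {j} {a} {d} {m} l≤m opt =
  subst (λ t → suc (suc j) * t ≤ suc m) (+-comm d 1) (C-ratio-≤₁ d (≤-trans (n≤1+n (suc j)) l≤m)
    (+-cancelˡ-≤ (a * c′) _ _ (begin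
      a * c′ + d * c′                    ≡⟨ sym (*-distribʳ-+ c′ a d) ⟩
      (a + d) * c′                       ≤⟨ topTwoOptimal⇒transfer-bound opt ⟩
      a * (d C suc j) + m C suc (suc j)  ≤⟨ +-monoˡ-≤ (m C suc (suc j))
                                              (*-monoʳ-≤ a (C-monoˡ-≤ (suc j) d≤m)) ⟩
      a * c′ + m C suc (suc j)           ∎)))
  where
  open ≤-Reasoning
  c′ : ℕ
  c′ = m C suc j
  d≤m : d ≤ m
  d≤m = <⇒≤ (topTwoOptimal⇒b≤m l≤m opt)

topTwoOptimal⇒lm[a+b]≤m[m+1]+lad : ∀ {j a d m} → suc (suc j) ≤ m → TopTwoOptimal (suc (suc j)) a (suc d) m →
  suc (suc j) * (m * (a + suc d)) ≤ m * suc m + suc (suc j) * (a * d)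
topTwoOptimal⇒lm[a+b]≤m[m+1]+lad {j} {a} {d} {m} l≤m opt =
  subst (λ t → suc (suc j) * t ≤ m * suc m + suc (suc j) * (a * d)) (regroupˡ m a d)
    (C-ratio-≤ (m * (a + d)) m (a * d) (≤-trans (n≤1+n (suc j)) l≤m) (begin
      m * (a + d) * c′               ≡⟨ *-assoc m (a + d) c′ ⟩
      m * ((a + d) * c′)             ≤⟨ *-monoʳ-≤ m (topTwoOptimal⇒transfer-bound opt) ⟩
      m * (a * (d C suc j) + c)      ≡⟨ spread m a (d C suc j) c ⟩
      a * (m * (d C suc j)) + m * c  ≤⟨ +-monoˡ-≤ (m * c) (*-monoʳ-≤ a (C/n-mono-≤ j d≤m)) ⟩
      a * (d * c′) + m * c           ≡⟨ regroupʳ a d c′ (m * c) ⟩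
      m * c + a * d * c′             ∎))
  where
  open ≤-Reasoning
  regroupˡ : ∀ m a d → m * (a + d) + m ≡ m * (a + suc d)
  regroupˡ = solve-∀
  spread : ∀ m a w c → m * (a * w + c) ≡ a * (m * w) + m * c
  spread = solve-∀
  regroupʳ : ∀ a d w u → a * (d * w) + u ≡ u + a * d * w
  regroupʳ = solve-∀
  c : ℕ
  c = m C suc (suc j)
  c′ : ℕ
  c′ = m C suc j
  d≤m : d ≤ m
  d≤m = <⇒≤ (topTwoOptimal⇒b≤m l≤m opt)

topTwoOptimal⇒l[a+b]<a+b+m : ∀ {j a b m} → suc (suc j) ≤ m → 0 < b → TopTwoOptimal (suc (suc j)) a b m →
  suc (suc j) * (a + b) < a + b + m
topTwoOptimal⇒l[a+b]<a+b+m {j} {a} {suc zero} {m} l≤m 0<b opt =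
  singleton a (topTwoOptimal⇒la+l≤m+1 0<b (≤-trans (n≤1+n (suc j)) l≤m) opt)
  where
  open ≤-Reasoning
  l : ℕ
  l = suc (suc j)
  reorder : ∀ a m → a + (m + 1) ≡ a + 1 + m
  reorder = solve-∀
  singleton : ∀ a → l * a + l ≤ m + 1 → l * (a + 1) < a + 1 + m
  singleton zero    _ = s≤s (≤-trans (≤-reflexive (*-identityʳ l)) l≤m)
  singleton (suc a) h = s≤s (begin
    l * (suc a + 1)  ≡⟨ trans (*-distribˡ-+ l (suc a) 1) (cong (l * suc a +_) (*-identityʳ l)) ⟩
    l * suc a + l    ≤⟨ h ⟩
    m + 1            ≤⟨ m≤n+m (m + 1) a ⟩
    a + (m + 1)      ≡⟨ reorder a m ⟩
    a + 1 + m        ∎)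
topTwoOptimal⇒l[a+b]<a+b+m {j} {a} {suc (suc d)} {m} l≤m _ opt = ≤-trans (s≤s key) slack
  where
  open ≤-Reasoning
  factor : ∀ m a → m * suc m + a * m ≡ m * (suc m + a)
  factor = solve-∀
  reorder : ∀ m a d → suc (suc m + a) + d ≡ a + suc (suc d) + m
  reorder = solve-∀
  l : ℕ
  l = suc (suc j)
  l[b-1]≤m : l * suc d ≤ m
  l[b-1]≤m = ≤-pred (≤-trans (*-monoʳ-< l (n<1+n (suc d))) (topTwoOptimal⇒lb≤m+1 l≤m opt))
  key : l * (a + suc (suc d)) ≤ suc m + a
  key = *-cancelˡ-≤ m {{>-nonZero (≤-trans (s≤s z≤n) l≤m)}} (begin
    m * (l * (a + suc (suc d)))  ≡⟨ x∙yz≈y∙xz m l (a + suc (suc d)) ⟩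
    l * (m * (a + suc (suc d)))  ≤⟨ topTwoOptimal⇒lm[a+b]≤m[m+1]+lad l≤m opt ⟩
    m * suc m + l * (a * suc d)  ≡⟨ cong (m * suc m +_) (x∙yz≈y∙xz l a (suc d)) ⟩
    m * suc m + a * (l * suc d)  ≤⟨ +-monoʳ-≤ (m * suc m) (*-monoʳ-≤ a l[b-1]≤m) ⟩
    m * suc m + a * m            ≡⟨ factor m a ⟩
    m * (suc m + a)              ∎)
  slack : suc (suc m + a) ≤ a + suc (suc d) + m
  slack = subst (suc (suc m + a) ≤_) (reorder m a d) (m≤m+n (suc (suc m + a)) d)

topTwoOptimal⇒[l+1]m≤l[a+b+m+1] : ∀ {j a b m} → suc (suc j) ≤ m → TopTwoOptimal (suc (suc j)) a b m →
  suc (suc (suc j)) * m ≤ suc (suc j) * (a + b + m + 1)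
topTwoOptimal⇒[l+1]m≤l[a+b+m+1] {j} {a} {b} {suc m} (s≤s j<m) opt = begin
  suc m + l * suc m          ≤⟨ +-monoˡ-≤ (l * suc m) (C-ratio-≥ (a + b) j<m split) ⟩
  l * (a + b + 1) + l * suc m ≡⟨ factor l (a + b) (suc m) ⟩
  l * (a + b + suc m + 1)    ∎
  where
  open ≤-Reasoning
  factor : ∀ l k m → l * (k + 1) + l * m ≡ l * (k + m + 1)
  factor = solve-∀
  lhs : ∀ a b x z → a * x + ((a + b) * 0 + ((a + b + 1) * z + 0)) ≡ (a * x + (a + b) * z) + z
  lhs = solve-∀
  rhs : ∀ a b x y z → a * x + ((a + b) * (y + z) + 0) ≡ (a * x + (a + b) * z) + (a + b) * y
  rhs = solve-∀
  l : ℕ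
  l = suc (suc j)
  split : m C l ≤ (a + b) * (m C suc j)
  split = +-cancelˡ-≤ (a * (b C l) + (a + b) * (m C l)) _ _ (begin
    a * (b C l) + (a + b) * (m C l) + m C l              ≡⟨ sym (lhs a b (b C l) (m C l)) ⟩
    layeredCount l a (b ∷ 1 ∷ m ∷ [])                    ≤⟨ opt (b ∷ 1 ∷ m ∷ [])
                                                             (cong (b +_) (cong suc (+-identityʳ m))) ⟩
    layeredCount l a (b ∷ suc m ∷ [])                    ≡⟨ cong (λ t → a * (b C l) + ((a + b) * t + 0))
                                                             (C-pascal m (suc j)) ⟩
    a * (b C l) + ((a + b) * (m C suc j + m C l) + 0)    ≡⟨ rhs a b (b C l) (m C suc j) (m C l) ⟩
    a * (b C l) + (a + b) * (m C l) + (a + b) * (m C suc j) ∎)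

compositionOptimal⇒bounds : ∀ {j} A b m k n → 0 < b → 0 < m → suc (suc (suc j)) ≤ n →
  sum A + b ≡ k → k + m ≡ n → CompositionOptimal (suc (suc j)) (A ++ b ∷ m ∷ []) →
  let l = suc (suc j) in
  (b ≤ m) × (l * (k ∸ b) + l ≤ m + 1) × ((l * k < n) × (k < m)) × (suc l * m ≤ l * (n + 1))
compositionOptimal⇒bounds {j} A b m _ _ 0<b 0<m l<n refl refl opt =
  topTwoOptimal⇒b≤m l≤m topTwo ,
  subst (λ a → l * a + l ≤ m + 1) (sym (m+n∸n≡m (sum A) b))
    (topTwoOptimal⇒la+l≤m+1 0<b (≤-trans (n≤1+n _) l≤m) topTwo) ,
  (lk<n , +-cancelˡ-< k k m (≤-<-trans (+-monoʳ-≤ k (m≤m+n k (j * k))) lk<n)) ,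
  topTwoOptimal⇒[l+1]m≤l[a+b+m+1] l≤m topTwo
  where
  l : ℕ
  l = suc (suc j)
  k : ℕ
  k = sum A + b
  topTwo : TopTwoOptimal l (sum A) b m
  topTwo = compositionOptimal⇒topTwoOptimal A b m opt
  l≤m : l ≤ m
  l≤m = compositionOptimal⇒l≤last (A ++ b ∷ []) m
    (subst (suc l ≤_) (sym total) l<n) 0<m
    (subst (CompositionOptimal l) (sym (++-assoc A (b ∷ []) (m ∷ []))) opt)
    where
    total : sum ((A ++ b ∷ []) ++ m ∷ []) ≡ k + m
    total = trans (sum-++ (A ++ b ∷ []) (m ∷ []))
                  (cong₂ _+_ (trans (sum-++ A (b ∷ [])) (cong (sum A +_) (+-identityʳ b))) (+-identityʳ m))
  lk<n : l * k < k + m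
  lk<n = topTwoOptimal⇒l[a+b]<a+b+m l≤m 0<b topTwo

nonEmpty⇒0<length : ∀ {xs} → NonEmpty xs → 0 < length xs
nonEmpty⇒0<length {[]}    ne = contradiction refl ne
nonEmpty⇒0<length {_ ∷ _} _  = s≤s z≤n

lemma5p1 : (l n k : ℕ) → 2 ≤ l → suc l ≤ n → IsKn l n k →
    (p : List ℕ) → (pre : List (List ℕ)) → (B L : List ℕ) →
    Layers (pre ++ B ∷ L ∷ []) p → Optimal (qpat l) n p →
    length L ≡ n ∸ k →
    let m = n ∸ k
        b = length B
        a = k ∸ b
    in (b ≤ m)
       × (l * a + l ≤ m + 1)
       × ((l * k < n) × (k < m))
       × ((suc l) * m ≤ l * (n + 1))
lemma5p1 (suc (suc j)) n k (s≤s (s≤s z≤n)) l<n (_ , k<n , _) p pre B L layers opt |L|≡m =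
  compositionOptimal⇒bounds A (length B) (n ∸ k) k n 0<b 0<m l<n a+b≡k k+m≡n
    (subst (CompositionOptimal (suc (suc j))) sizes (optimal⇒compositionOptimal layers opt))
  where
  A : List ℕ
  A = map length pre
  sizes : map length (pre ++ B ∷ L ∷ []) ≡ A ++ length B ∷ n ∸ k ∷ []
  sizes = trans (map-++ length pre (B ∷ L ∷ [])) (cong (λ m → A ++ length B ∷ m ∷ []) |L|≡m)
  k+m≡n : k + (n ∸ k) ≡ n
  k+m≡n = m+[n∸m]≡n (<⇒≤ k<n)
  total : sum A + (length B + (n ∸ k)) ≡ n
  total = trans (cong (λ t → sum A + (length B + t)) (sym (+-identityʳ (n ∸ k))))
            (trans (sym (sum-++ A (length B ∷ n ∸ k ∷ [])))
              (trans (cong sum (sym sizes)) (layers-total layers (proj₁ opt))))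
  a+b≡k : sum A + length B ≡ k
  a+b≡k = +-cancelʳ-≡ (n ∸ k) _ _ (trans (+-assoc (sum A) (length B) (n ∸ k)) (trans total (sym k+m≡n)))
  topNonEmpty : All NonEmpty (B ∷ L ∷ [])
  topNonEmpty = All.++⁻ʳ pre (proj₁ (proj₂ layers))
  0<b : 0 < length B
  0<b = nonEmpty⇒0<length (All.head topNonEmpty)
  0<m : 0 < n ∸ k
  0<m = subst (0 <_) |L|≡m (nonEmpty⇒0<length (All.head (All.tail topNonEmpty)))
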